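{- For any group $G$, the power graph $\mathfrak{g}(G)$ contains no anti-hole of length greater than $4$.
   Context: The power graph $\mathfrak{g}(G)$ has vertex set $G$, distinct $x,y$ adjacent iff $\langle x\rangle\le\langle y\rangle$ or $\langle y\rangle\le\langle x\rangle$. A hole is a chordless cycle (a cycle none of whose vertices are joined by an edge outside the cycle); an anti-hole of length $n$ is an induced subgraph on $n$ vertices that is the complement of a hole of length $n$, i.e. isomorphic to the complement of the cycle $C_n$. -}

module Defs where

open import Level using (Level; _⊔_)
open import Algebra.Bundles using (Group)
open import Data.Nat using (ℕ; zero; suc; _+_)
open import Data.Integer using (ℤ; +_; -[1+_])
open import Data.Fin using (Fin; toℕ)
open import Data.Product using (Σ; ∃; _×_)
open import Data.Sum using (_⊎_)
open import Relation.Nullary using (¬_)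
open import Relation.Binary.PropositionalEquality using (_≡_)

module PowerGraph {c ℓ : Level} (G : Group c ℓ) where
  open Group G

  _^ℕ_ : Carrier → ℕ → Carrier
  x ^ℕ zero = ε
  x ^ℕ suc n = x ∙ (x ^ℕ n)

  _^ℤ_ : Carrier → ℤ → Carrier
  x ^ℤ (+ n) = x ^ℕ n
  x ^ℤ -[1+ n ] = (x ^ℕ suc n) ⁻¹

  _∈⟨_⟩ : Carrier → Carrier → Set ℓ
  x ∈⟨ y ⟩ = Σ ℤ λ k → x ≈ (y ^ℤ k)

  -- adjacency in the power graph (for distinct vertices)
  Adj : Carrier → Carrier → Set ℓ
  Adj x y = (x ∈⟨ y ⟩) ⊎ (y ∈⟨ x ⟩)

  CycSucc : (n : ℕ) → Fin n → Fin n → Set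
  CycSucc n i j = (suc (toℕ i) ≡ toℕ j) ⊎ ((suc (toℕ i) ≡ n) × (toℕ j ≡ 0))

  CycAdj : (n : ℕ) → Fin n → Fin n → Set
  CycAdj n i j = CycSucc n i j ⊎ CycSucc n j i

  -- v : Fin n → G induces an anti-hole of length n in the power graph:
  -- the vertices are pairwise distinct and, for i ≠ j, v i ~ v j iff
  -- i and j are not consecutive on the n-cycle (complement of C_n).
  IsAntiHole : (n : ℕ) → (Fin n → Carrier) → Set ℓ
  IsAntiHole n v =
    (∀ i j → v i ≈ v j → i ≡ j) ×
    (∀ i j → ¬ (i ≡ j) → (Adj (v i) (v j) → ¬ CycAdj n i j) × (¬ CycAdj n i j → Adj (v i) (v j)))

  HasAntiHole : ℕ → Set (c ⊔ ℓ)
  HasAntiHole n = Σ (Fin n → Carrier) λ v → IsAntiHole n v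

-- Membership in cyclic subgroups, x ∈⟨ y ⟩, is a transitive relation, and the power graph is its
-- comparability graph.  So it suffices to show that no transitive relation R on the indices
-- 0, …, k (k ≥ 4) has as comparability graph the complement of the cycle 0 – 1 – ⋯ – k – 0.
-- Up to reversing R we may assume R 0 2.  Then R 0 3 (else R 3 2), hence R 1 3 (else R 0 1),
-- and inductively R 1 j for all j ≥ 3 (else R (j+1) j); in particular R 1 k.  Moreover R k 2
-- (else R 0 k), so R 1 2, contradicting that 1 and 2 are adjacent on the cycle.
module Submission where

open import Defs
open import Level using (Level)
open import Algebra.Bundles using (Group)
open import Data.Nat using (ℕ; zero; suc; _+_; _*_; _≤_; _<_; z≤n; s≤s)
open import Relation.Nullary using (¬_)
open import Data.Nat.Properties using (≤-refl; ≤-trans; m≤m+n; ≤-reflexive; <⇒≤; <⇒≢; <⇒≱; m<n⇒n≢0; suc-injective; m≤n⇒∃[o]m+o≡n)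
open import Data.Nat.DivMod using (_mod_; m≤n⇒m%n≡m)
open import Data.Integer using (+_; -[1+_]; -_)
open import Data.Fin using (Fin; toℕ)
open import Data.Fin.Properties using (toℕ-fromℕ<)
open import Data.Product using (_,_; proj₁; proj₂)
open import Data.Sum using (_⊎_; inj₁; inj₂; [_,_]′; swap)
open import Data.Empty using (⊥-elim)
open import Function using (id; _∘_; flip)
open import Relation.Binary.Core using (Rel)
open import Relation.Binary.Definitions using (Transitive)
import Relation.Binary.Construct.Flip.Ord as Flip
open import Relation.Binary.PropositionalEquality as ≡ using (_≡_; _≢_)
import Algebra.Properties.Group as GroupProperties
import Algebra.Properties.Monoid.Mult as MonoidMult
import Relation.Binary.Reasoning.Setoid as SetoidReasoning

Comparable : ∀ {a} {A : Set} → Rel A a → Rel A a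
Comparable R x y = R x y ⊎ R y x

module _ {a} {A : Set} (R : Rel A a) where

  comparable-forward : ∀ {x y} → Comparable R x y → ¬ R y x → R x y
  comparable-forward xy ¬yx = [ id , ⊥-elim ∘ ¬yx ]′ xy

  comparable-backward : ∀ {x y} → Comparable R x y → ¬ R x y → R y x
  comparable-backward xy = comparable-forward (swap xy)

record AntiCycle {a} (R : Rel ℕ a) (k : ℕ) : Set a where
  field
    adjacent-incomparable : ∀ i → suc i ≤ k → ¬ Comparable R i (suc i)
    closing-incomparable  : ¬ Comparable R k 0
    distant-comparable    : ∀ {i j} → 2 + i ≤ j → j ≤ k → 0 < i ⊎ j < k → Comparable R i j

module _ {a} {R : Rel ℕ a} where

  antiCycle-flip : ∀ {k} → AntiCycle R k → AntiCycle (flip R) k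
  antiCycle-flip anti = record
    { adjacent-incomparable = λ i lt c → adjacent-incomparable i lt (swap c)
    ; closing-incomparable  = λ c → closing-incomparable (swap c)
    ; distant-comparable    = λ le lt h → swap (distant-comparable le lt h)
    }
    where open AntiCycle anti

  antiCycle-¬R02 : Transitive R → ∀ {k} → 4 ≤ k → AntiCycle R k → ¬ R 0 2
  antiCycle-¬R02 R-trans 4≤k anti r02 with m≤n⇒∃[o]m+o≡n 4≤k
  ... | m , ≡.refl = adjacent-incomparable 1 (s≤s (s≤s z≤n)) (inj₁ (R-trans r1k rk2))
    where
    open AntiCycle anti
    r03 : R 0 3
    r03 = comparable-forward R (distant-comparable (s≤s (s≤s z≤n)) (m≤m+n 3 (suc m)) (inj₂ (m≤m+n 4 m)))
            (λ r30 → adjacent-incomparable 2 (s≤s (s≤s (s≤s z≤n))) (inj₂ (R-trans r30 r02)))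
    r13 : R 1 3
    r13 = comparable-forward R (distant-comparable (s≤s (s≤s (s≤s z≤n))) (m≤m+n 3 (suc m)) (inj₁ (s≤s z≤n)))
            (λ r31 → adjacent-incomparable 0 (s≤s z≤n) (inj₁ (R-trans r03 r31)))
    r1[3+t] : ∀ t → 3 + t ≤ 4 + m → R 1 (3 + t)
    r1[3+t] zero    _  = r13
    r1[3+t] (suc t) le = comparable-forward R (distant-comparable (s≤s (s≤s (s≤s z≤n))) le (inj₁ (s≤s z≤n)))
            (λ r → adjacent-incomparable (3 + t) le (inj₂ (R-trans r (r1[3+t] t (<⇒≤ le)))))
    r1k : R 1 (4 + m)
    r1k = r1[3+t] (suc m) ≤-refl
    rk2 : R (4 + m) 2
    rk2 = comparable-backward R (distant-comparable (m≤m+n 4 m) ≤-refl (inj₁ (s≤s z≤n)))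
            (λ r2k → closing-incomparable (inj₂ (R-trans r02 r2k)))

transitive-¬antiCycle : ∀ {a} {R : Rel ℕ a} → Transitive R → ∀ {k} → 4 ≤ k → ¬ AntiCycle R k
transitive-¬antiCycle {R = R} R-trans {k} 4≤k anti =
  [ antiCycle-¬R02 R-trans 4≤k anti
  , antiCycle-¬R02 (Flip.transitive R R-trans) 4≤k (antiCycle-flip anti)
  ]′ (distant-comparable ≤-refl (<⇒≤ 2<k) (inj₂ 2<k))
  where
  open AntiCycle anti
  2<k : 2 < k
  2<k = <⇒≤ 4≤k

module _ {c ℓ : Level} (G : Group c ℓ) where
  open Group G
  open PowerGraph G
  open GroupProperties G using (ε⁻¹≈ε; ⁻¹-involutive; ⁻¹-anti-homo-∙)
  open MonoidMult monoid using (_×_; ×-congʳ; ×-assocˡ)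
  open SetoidReasoning setoid

  ^ℕ-cong : ∀ {x y} n → x ≈ y → x ^ℕ n ≈ y ^ℕ n
  ^ℕ-cong zero    x≈y = refl
  ^ℕ-cong (suc n) x≈y = ∙-cong x≈y (^ℕ-cong n x≈y)

  ^ℕ≈× : ∀ x n → x ^ℕ n ≈ n × x
  ^ℕ≈× x zero    = refl
  ^ℕ≈× x (suc n) = ∙-cong refl (^ℕ≈× x n)

  ^ℕ-^ℕ : ∀ x m n → (x ^ℕ m) ^ℕ n ≈ x ^ℕ (n * m)
  ^ℕ-^ℕ x m n = begin
    (x ^ℕ m) ^ℕ n ≈⟨ ^ℕ≈× (x ^ℕ m) n ⟩
    n × (x ^ℕ m)  ≈⟨ ×-congʳ n (^ℕ≈× x m) ⟩
    n × (m × x)   ≈⟨ ×-assocˡ x n m ⟩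
    (n * m) × x   ≈⟨ ^ℕ≈× x (n * m) ⟨
    x ^ℕ (n * m)  ∎

  ∙-^ℕ-comm : ∀ x n → x ∙ x ^ℕ n ≈ x ^ℕ n ∙ x
  ∙-^ℕ-comm x zero    = trans (identityʳ x) (sym (identityˡ x))
  ∙-^ℕ-comm x (suc n) = trans (∙-cong refl (∙-^ℕ-comm x n)) (sym (assoc x (x ^ℕ n) x))

  ⁻¹-^ℕ : ∀ x n → (x ⁻¹) ^ℕ n ≈ (x ^ℕ n) ⁻¹
  ⁻¹-^ℕ x zero    = sym ε⁻¹≈ε
  ⁻¹-^ℕ x (suc n) = begin
    x ⁻¹ ∙ (x ⁻¹) ^ℕ n  ≈⟨ ∙-cong refl (⁻¹-^ℕ x n) ⟩
    x ⁻¹ ∙ (x ^ℕ n) ⁻¹  ≈⟨ ⁻¹-anti-homo-∙ (x ^ℕ n) x ⟨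
    (x ^ℕ n ∙ x) ⁻¹     ≈⟨ ⁻¹-cong (∙-^ℕ-comm x n) ⟨
    (x ∙ x ^ℕ n) ⁻¹     ∎

  ⁻¹-^ℤ : ∀ x k → (x ^ℤ k) ⁻¹ ≈ x ^ℤ (- k)
  ⁻¹-^ℤ x (+ zero)  = ε⁻¹≈ε
  ⁻¹-^ℤ x (+ suc n) = refl
  ⁻¹-^ℤ x -[1+ n ]  = ⁻¹-involutive (x ^ℕ suc n)

  ∈⟨⟩-respˡ-≈ : ∀ {x y z} → x ≈ y → y ∈⟨ z ⟩ → x ∈⟨ z ⟩
  ∈⟨⟩-respˡ-≈ x≈y (k , y≈zᵏ) = k , trans x≈y y≈zᵏ

  ∈⟨⟩-⁻¹ : ∀ {x z} → x ∈⟨ z ⟩ → (x ⁻¹) ∈⟨ z ⟩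
  ∈⟨⟩-⁻¹ {z = z} (k , x≈zᵏ) = - k , trans (⁻¹-cong x≈zᵏ) (⁻¹-^ℤ z k)

  ^ℤ-^ℕ-∈⟨⟩ : ∀ z k n → ((z ^ℤ k) ^ℕ n) ∈⟨ z ⟩
  ^ℤ-^ℕ-∈⟨⟩ z (+ m)     n = + (n * m) , ^ℕ-^ℕ z m n
  ^ℤ-^ℕ-∈⟨⟩ z -[1+ m ]  n =
    ∈⟨⟩-respˡ-≈ (⁻¹-^ℕ (z ^ℕ suc m) n) (∈⟨⟩-⁻¹ (+ (n * suc m) , ^ℕ-^ℕ z (suc m) n))

  ∈⟨⟩-^ℕ : ∀ {x z} n → x ∈⟨ z ⟩ → (x ^ℕ n) ∈⟨ z ⟩
  ∈⟨⟩-^ℕ {z = z} n (k , x≈zᵏ) = ∈⟨⟩-respˡ-≈ (^ℕ-cong n x≈zᵏ) (^ℤ-^ℕ-∈⟨⟩ z k n)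

  ∈⟨⟩-^ℤ : ∀ {x z} k → x ∈⟨ z ⟩ → (x ^ℤ k) ∈⟨ z ⟩
  ∈⟨⟩-^ℤ (+ n)    x∈⟨z⟩ = ∈⟨⟩-^ℕ n x∈⟨z⟩
  ∈⟨⟩-^ℤ -[1+ n ] x∈⟨z⟩ = ∈⟨⟩-⁻¹ (∈⟨⟩-^ℕ (suc n) x∈⟨z⟩)

  ∈⟨⟩-trans : Transitive _∈⟨_⟩
  ∈⟨⟩-trans (k , x≈yᵏ) y∈⟨z⟩ = ∈⟨⟩-respˡ-≈ x≈yᵏ (∈⟨⟩-^ℤ k y∈⟨z⟩)

toℕ-mod : ∀ {i k} → i ≤ k → toℕ (i mod suc k) ≡ i
toℕ-mod i≤k = ≡.trans (toℕ-fromℕ< _) (m≤n⇒m%n≡m i≤k)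

mod-injective : ∀ {i j k} → i ≤ k → j ≤ k → i mod suc k ≡ j mod suc k → i ≡ j
mod-injective i≤k j≤k e = ≡.trans (≡.sym (toℕ-mod i≤k)) (≡.trans (≡.cong toℕ e) (toℕ-mod j≤k))

module _ {c ℓ : Level} (G : Group c ℓ) where
  open Group G using (Carrier)
  open PowerGraph G

  cycAdj-suc : ∀ {i k} → suc i ≤ k → CycAdj (suc k) (i mod suc k) (suc i mod suc k)
  cycAdj-suc 1+i≤k = inj₁ (inj₁ (≡.trans (≡.cong suc (toℕ-mod (<⇒≤ 1+i≤k))) (≡.sym (toℕ-mod 1+i≤k))))

  cycAdj-closing : ∀ {k} → CycAdj (suc k) (k mod suc k) (0 mod suc k)
  cycAdj-closing {k} = inj₁ (inj₂ (≡.cong suc (toℕ-mod ≤-refl) , toℕ-mod {k = k} z≤n))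

  distant-¬cycAdj : ∀ {i j k} → 2 + i ≤ j → j ≤ k → 0 < i ⊎ j < k →
                    ¬ CycAdj (suc k) (i mod suc k) (j mod suc k)
  distant-¬cycAdj {i} {j} 2+i≤j j≤k 0<i⊎j<k
    rewrite toℕ-mod (≤-trans (<⇒≤ (<⇒≤ 2+i≤j)) j≤k) | toℕ-mod j≤k = λ where
      (inj₁ (inj₁ 1+i≡j))           → <⇒≢ 2+i≤j 1+i≡j
      (inj₁ (inj₂ (_ , j≡0)))       → m<n⇒n≢0 2+i≤j j≡0
      (inj₂ (inj₁ 1+j≡i))           → <⇒≱ (<⇒≤ 2+i≤j) (<⇒≤ (≤-reflexive 1+j≡i))
      (inj₂ (inj₂ (1+j≡1+k , i≡0))) →
        [ (λ 0<i → m<n⇒n≢0 0<i i≡0) , (λ j<k → <⇒≢ j<k (suc-injective 1+j≡1+k)) ]′ 0<i⊎j<k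

  -- i mod suc k is only ever applied to i ≤ k: it serves as a total map ℕ → Fin (suc k).
  antiHole⇒antiCycle : ∀ {k} {v : Fin (suc k) → Carrier} → 0 < k → IsAntiHole (suc k) v →
                       AntiCycle (λ i j → v (i mod suc k) ∈⟨ v (j mod suc k) ⟩) k
  antiHole⇒antiCycle {k} 0<k (_ , adjacency) = record
    { adjacent-incomparable = λ i 1+i≤k comparable →
        proj₁ (adjacency _ _ (distinct (<⇒≤ 1+i≤k) 1+i≤k (<⇒≢ ≤-refl)))
          comparable (cycAdj-suc 1+i≤k)
    ; closing-incomparable  = λ comparable →
        proj₁ (adjacency _ _ (distinct ≤-refl z≤n (m<n⇒n≢0 0<k))) comparable cycAdj-closing
    ; distant-comparable    = λ 2+i≤j j≤k 0<i⊎j<k →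
        proj₂ (adjacency _ _ (distinct (≤-trans (<⇒≤ (<⇒≤ 2+i≤j)) j≤k) j≤k (<⇒≢ (<⇒≤ 2+i≤j))))
          (distant-¬cycAdj 2+i≤j j≤k 0<i⊎j<k)
    }
    where
    distinct : ∀ {i j} → i ≤ k → j ≤ k → i ≢ j → i mod suc k ≢ j mod suc k
    distinct i≤k j≤k i≢j e = i≢j (mod-injective i≤k j≤k e)

proposition22 : {c ℓ : Level} (G : Group c ℓ) (n : ℕ) → 4 < n → ¬ PowerGraph.HasAntiHole G n
proposition22 G (suc k) (s≤s 4≤k) (_ , antiHole) =
  transitive-¬antiCycle (∈⟨⟩-trans G) 4≤k (antiHole⇒antiCycle G (≤-trans (s≤s z≤n) 4≤k) antiHole)
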